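{- Let $(S,\bullet)$ be a partial semigroup, let $L$ be a minimal left ideal of $S$, and let $T\subseteq S$ with $\bigcap_{s\in L}(R(s)\cap T)\neq\emptyset$. Then $T$ is a minimal left ideal of $S$ if and only if there is some $a\in\bigcap_{s\in L}(R(s)\cap T)$ such that $T=L\bullet a$.
   Context: A partial semigroup is a nonempty set $S$ with a partially defined operation $\bullet$ such that $(x\bullet y)\bullet z=x\bullet(y\bullet z)$ in the sense that if either side is defined so is the other and they are equal. $R(x)=\{s:x\bullet s\text{ defined}\}$, $L(x)=\{s:s\bullet x\text{ defined}\}$. A left ideal is a nonempty $I\subseteq S$ with $y\bullet x\in I$ whenever $x\in I$ and $y\in L(x)$; minimal if it contains no other left ideal. $L\bullet a=\{s\bullet a:s\in L\}$. -}

module Defs where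

open import Level using (Level; _⊔_) renaming (suc to lsuc)
open import Data.Maybe using (Maybe; just; nothing; _>>=_)
open import Data.Product using (Σ; ∃; _×_; _,_)
open import Relation.Binary.PropositionalEquality using (_≡_)
open import Function.Bundles using (_⇔_)

-- Associativity as Maybe-equality says exactly:
-- if either side of (x•y)•z = x•(y•z) is defined, so is the other and
-- they are equal.
record PartialSemigroup (c : Level) : Set (lsuc c) where
  field
    Carrier  : Set c
    _∙_      : Carrier → Carrier → Maybe Carrier
    inhabited : Carrier
    assoc    : ∀ x y z →
               ((x ∙ y) >>= λ xy → xy ∙ z) ≡ ((y ∙ z) >>= λ yz → x ∙ yz)

module _ {c : Level} (S : PartialSemigroup c) where
  open PartialSemigroup S

  Subset : (ℓ : Level) → Set (c ⊔ lsuc ℓ)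
  Subset ℓ = Carrier → Set ℓ

  Defined : Carrier → Carrier → Set c
  Defined x y = ∃ λ z → x ∙ y ≡ just z

  R : Carrier → Subset c
  R x s = Defined x s

  L : Carrier → Subset c
  L x s = Defined s x

  _⊆_ : ∀ {ℓ ℓ'} → Subset ℓ → Subset ℓ' → Set (c ⊔ ℓ ⊔ ℓ')
  A ⊆ B = ∀ x → A x → B x

  _≐_ : ∀ {ℓ ℓ'} → Subset ℓ → Subset ℓ' → Set (c ⊔ ℓ ⊔ ℓ')
  A ≐ B = (A ⊆ B) × (B ⊆ A)

  IsLeftIdeal : ∀ {ℓ} → Subset ℓ → Set (c ⊔ ℓ)
  IsLeftIdeal I =
    (∃ λ x → I x) ×
    (∀ x y z → I x → y ∙ x ≡ just z → I z)

  IsMinimalLeftIdeal : ∀ {ℓ} → Subset ℓ → Set (c ⊔ lsuc ℓ)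
  IsMinimalLeftIdeal {ℓ} I =
    IsLeftIdeal I × (∀ (J : Subset ℓ) → IsLeftIdeal J → J ⊆ I → I ⊆ J)

  _∙ₛ_ : ∀ {ℓ} → Subset ℓ → Carrier → Subset (c ⊔ ℓ)
  (A ∙ₛ a) t = ∃ λ s → A s × (s ∙ a ≡ just t)

  ⋂R∩ : ∀ {ℓ ℓ'} → Subset ℓ → Subset ℓ' → Subset (c ⊔ ℓ ⊔ ℓ')
  ⋂R∩ A T a = ∀ s → A s → (R s a × T a)

{-# OPTIONS --safe #-}
module Submission where

-- For a ∈ ⋂_{s ∈ L} R(s), associativity turns y • (s • a) into (y • s) • a, so L • a is a
-- left ideal; it is minimal because for a left ideal J ⊆ L • a the set {s ∈ L : s • a ∈ J}
-- is a left ideal inside L, hence all of L. If moreover a ∈ T and T is a minimal left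
-- ideal, then L • a ⊆ T forces T = L • a; conversely anything equal to L • a is minimal.

open import Defs
open import Level using (Level; _⊔_)
open import Data.Maybe using (Maybe; just; _>>=_)
open import Data.Product using (∃; _×_; _,_; proj₁; proj₂)
open import Function.Bundles using (_⇔_; mk⇔)
open import Relation.Binary.PropositionalEquality using (_≡_; refl; sym; trans; cong; module ≡-Reasoning)

>>=-just-inv : ∀ {a b} {A : Set a} {B : Set b} (m : Maybe A) (f : A → Maybe B) {z : B} →
               (m >>= f) ≡ just z → ∃ λ u → m ≡ just u × f u ≡ just z
>>=-just-inv (just u) f eq = u , refl , eq

module _ {c : Level} (S : PartialSemigroup c) where
  open PartialSemigroup S

  assoc-ʳ⇒ˡ : ∀ {y s a t z} → s ∙ a ≡ just t → y ∙ t ≡ just z →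
              ∃ λ u → y ∙ s ≡ just u × u ∙ a ≡ just z
  assoc-ʳ⇒ˡ {y} {s} {a} sa≡t yt≡z = >>=-just-inv (y ∙ s) (_∙ a)
    (trans (assoc y s a) (trans (cong (_>>= (y ∙_)) sa≡t) yt≡z))

  assoc-ˡ⇒ʳ : ∀ {y s a u t z} → y ∙ s ≡ just u → u ∙ a ≡ just z → s ∙ a ≡ just t →
              y ∙ t ≡ just z
  assoc-ˡ⇒ʳ {y} {s} {a} {u} {t} {z} ys≡u ua≡z sa≡t = begin
    y ∙ t                           ≡⟨ cong (_>>= (y ∙_)) sa≡t ⟨
    ((s ∙ a) >>= (y ∙_))            ≡⟨ assoc y s a ⟨
    ((y ∙ s) >>= (_∙ a))            ≡⟨ cong (_>>= (_∙ a)) ys≡u ⟩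
    u ∙ a                           ≡⟨ ua≡z ⟩
    just z                          ∎
    where open ≡-Reasoning

  ⋂R : ∀ {ℓ} → Subset S ℓ → Subset S (c ⊔ ℓ)
  ⋂R A a = ∀ s → A s → R S s a

  ∙ₛ-isLeftIdeal : ∀ {ℓ} {A : Subset S ℓ} {a} → IsLeftIdeal S A → ⋂R A a →
                   IsLeftIdeal S (_∙ₛ_ S A a)
  ∙ₛ-isLeftIdeal {A = A} {a} ((s , As) , closed) a∈⋂R =
    let (t , sa≡t) = a∈⋂R s As in (t , s , As , sa≡t) , closedₐ
    where
    closedₐ : ∀ t y z → _∙ₛ_ S A a t → y ∙ t ≡ just z → _∙ₛ_ S A a z
    closedₐ t y z (s , As , sa≡t) yt≡z =
      let (u , ys≡u , ua≡z) = assoc-ʳ⇒ˡ sa≡t yt≡z in u , closed s y u As ys≡u , ua≡z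

  ∙ₛ-isMinimalLeftIdeal : ∀ {L : Subset S c} {a} → IsMinimalLeftIdeal S L → ⋂R L a →
                          IsMinimalLeftIdeal S (_∙ₛ_ S L a)
  ∙ₛ-isMinimalLeftIdeal {L} {a} (L-ideal@(_ , L-closed) , L-minimal) a∈⋂R =
    ∙ₛ-isLeftIdeal L-ideal a∈⋂R , La⊆J
    where
    La⊆J : ∀ J → IsLeftIdeal S J → _⊆_ S J (_∙ₛ_ S L a) → _⊆_ S (_∙ₛ_ S L a) J
    La⊆J J ((j , Jj) , J-closed) J⊆La t (s , Ls , sa≡t) = Jt
      where
      K : Subset S c
      K s = L s × ∃ λ j → s ∙ a ≡ just j × J j

      K-closed : ∀ s y z → K s → y ∙ s ≡ just z → K z
      K-closed s y z (Ls , j , sa≡j , Jj) ys≡z =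
        let Lz = L-closed s y z Ls ys≡z
            (w , za≡w) = a∈⋂R z Lz
        in Lz , w , za≡w , J-closed j y w Jj (assoc-ˡ⇒ʳ ys≡z za≡w sa≡j)

      K-nonempty : ∃ K
      K-nonempty = let (s , Ls , sa≡j) = J⊆La j Jj in s , Ls , j , sa≡j , Jj

      Jt : J t
      Jt with L-minimal K (K-nonempty , K-closed) (λ _ → proj₁) s Ls
      ... | _ , j , sa≡j , Jj with trans (sym sa≡t) sa≡j
      ... | refl = Jj

  ∙ₛ-⊆-leftIdeal : ∀ {ℓ ℓ'} {A : Subset S ℓ} {I : Subset S ℓ'} {a} → IsLeftIdeal S I → I a →
                   _⊆_ S (_∙ₛ_ S A a) I
  ∙ₛ-⊆-leftIdeal {a = a} (_ , closed) Ia t (s , _ , sa≡t) = closed a s t Ia sa≡t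

  isMinimalLeftIdeal-resp-≐ : ∀ {ℓ} {A B : Subset S ℓ} → _≐_ S A B →
                              IsMinimalLeftIdeal S A → IsMinimalLeftIdeal S B
  isMinimalLeftIdeal-resp-≐ (A⊆B , B⊆A) (((x , Ax) , A-closed) , A-minimal) =
    ((x , A⊆B x Ax) , λ u y z Bu yu≡z → A⊆B z (A-closed u y z (B⊆A u Bu) yu≡z)) ,
    λ J J-ideal J⊆B t Bt →
      A-minimal J J-ideal (λ x Jx → B⊆A x (J⊆B x Jx)) t (B⊆A t Bt)

theorem2p14 : {c : Level} (S : PartialSemigroup c) (L T : Subset S c) →
    IsMinimalLeftIdeal S L →
    (∃ λ a → ⋂R∩ S L T a) →
    IsMinimalLeftIdeal S T ⇔ (∃ λ a → ⋂R∩ S L T a × _≐_ S T (_∙ₛ_ S L a))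
theorem2p14 S L T L-minimal@(((l , Ll) , _) , _) (a₀ , a₀∈⋂R∩) = mk⇔ to from
  where
  ⋂R∩⇒⋂R : ∀ {a} → ⋂R∩ S L T a → ⋂R S L a
  ⋂R∩⇒⋂R a∈⋂R∩ s Ls = proj₁ (a∈⋂R∩ s Ls)

  to : IsMinimalLeftIdeal S T → ∃ λ a → ⋂R∩ S L T a × _≐_ S T (_∙ₛ_ S L a)
  to (T-ideal , T-minimal) = a₀ , a₀∈⋂R∩ , T-minimal _ La₀-ideal La₀⊆T , La₀⊆T
    where
    La₀-ideal : IsLeftIdeal S (_∙ₛ_ S L a₀)
    La₀-ideal = ∙ₛ-isLeftIdeal S (proj₁ L-minimal) (⋂R∩⇒⋂R a₀∈⋂R∩)
    La₀⊆T : _⊆_ S (_∙ₛ_ S L a₀) T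
    La₀⊆T = ∙ₛ-⊆-leftIdeal S T-ideal (proj₂ (a₀∈⋂R∩ l Ll))

  from : (∃ λ a → ⋂R∩ S L T a × _≐_ S T (_∙ₛ_ S L a)) → IsMinimalLeftIdeal S T
  from (a , a∈⋂R∩ , T≐La) =
    isMinimalLeftIdeal-resp-≐ S (proj₂ T≐La , proj₁ T≐La)
      (∙ₛ-isMinimalLeftIdeal S L-minimal (⋂R∩⇒⋂R a∈⋂R∩))
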